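{- Let $G$ be a $(P_5,\textit{HVN})$-free graph containing an induced $T$-5-wheel $\Sigma$, with the notation below. Then $S$ is (i) anticomplete to $R_1\cup R_3\cup R_4\cup R_{1,x}\cup R_{2,x}\cup R_{5,x}\cup\bar R_1\cup\bar R_{1,x}\cup\bar R_3\cup\bar R_{3,x}$, and (ii) anticomplete to $P^2\cup P^4$.
   Context: Graphs are finite, simple and connected. $P_5$ is the path on 5 vertices; an HVN is a $K_4$ plus a vertex adjacent to exactly two vertices of the $K_4$; $(H_1,H_2)$-free means no induced $H_1$ or $H_2$. $A$ is anticomplete to $B$ if no vertex of $A$ is adjacent to a vertex of $B$. A $T$-5-wheel is an induced cycle $C=v_1v_2v_3v_4v_5v_1$ together with a vertex $x$ adjacent to exactly $v_1,v_2,v_5$ on $C$; here $\Sigma$ is such an induced subgraph of $G$. Indices are modulo 5. For $u\in V(G)$, $N_C(u)$ and $N_\Sigma(u)$ denote the sets of neighbours of $u$ in $V(C)$ and $V(\Sigma)$. For $i\in\{1,\dots,5\}$, among vertices $u$ with $ux\notin E(G)$ (including $x$): $R_i=\{u: N_C(u)=\{v_{i-1},v_{i+1}\}\}$, $\bar R_i=\{u: N_C(u)=\{v_{i-1},v_i,v_{i+1}\}\}$, $P^i=\{u: N_C(u)=\{v_{i-1},v_i,v_{i+1},v_{i+2}\}\}$. Further $S=\{u: N_\Sigma(u)=\emptyset\}$, $R_{i,x}=\{u: N_\Sigma(u)=\{v_{i-1},v_{i+1},x\}\}$, $\bar R_{i,x}=\{u: N_\Sigma(u)=\{v_{i-1},v_i,v_{i+1},x\}\}$.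 -}

module Defs where

open import Data.Nat using (ℕ)
open import Data.Fin using (Fin; zero; suc; inject₁; fromℕ; _≟_)
open import Data.Bool using (Bool; true; false; _∨_; not)
open import Relation.Nullary.Decidable using (⌊_⌋)
open import Relation.Binary.PropositionalEquality using (_≡_; _≢_)
open import Data.Product using (Σ; _×_; ∃; proj₁)
open import Data.Maybe using (Maybe; just; nothing)
open import Data.Sum using (_⊎_)
open import Data.Empty using (⊥)

data Reach {n : ℕ} (adj : Fin n → Fin n → Bool) : Fin n → Fin n → Set where
  here : ∀ {a} → Reach adj a a
  step : ∀ {a b c} → adj a b ≡ true → Reach adj b c → Reach adj a c

record Graph : Set where
  field
    n       : ℕ
    adj     : Fin n → Fin n → Bool
    sym     : ∀ a b → adj a b ≡ adj b a
    irrefl  : ∀ a → adj a a ≡ false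
    connected : ∀ a b → Reach adj a b

open Graph public

InducedCopy : (G : Graph) {k : ℕ} → (Fin k → Fin k → Bool) → Set
InducedCopy G {k} H =
  Σ (Fin k → Fin (n G)) λ f →
    (∀ i j → f i ≡ f j → i ≡ j) × (∀ i j → adj G (f i) (f j) ≡ H i j)

Free : (G : Graph) {k : ℕ} → (Fin k → Fin k → Bool) → Set
Free G H = InducedCopy G H → ⊥

eqb : {k : ℕ} → Fin k → Fin k → Bool
eqb i j = ⌊ i ≟ j ⌋

P5 : Fin 5 → Fin 5 → Bool
P5 zero (suc zero) = true
P5 (suc zero) zero = true
P5 (suc zero) (suc (suc zero)) = true
P5 (suc (suc zero)) (suc zero) = true
P5 (suc (suc zero)) (suc (suc (suc zero))) = true
P5 (suc (suc (suc zero))) (suc (suc zero)) = true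
P5 (suc (suc (suc zero))) (suc (suc (suc (suc zero)))) = true
P5 (suc (suc (suc (suc zero)))) (suc (suc (suc zero))) = true
P5 _ _ = false

-- HVN : K4 on {0,1,2,3} plus vertex 4 adjacent exactly to 0 and 1
HVN : Fin 5 → Fin 5 → Bool
HVN (suc (suc (suc (suc zero)))) j = eqb j zero ∨ eqb j (suc zero)
HVN i (suc (suc (suc (suc zero)))) = eqb i zero ∨ eqb i (suc zero)
HVN i j = not (eqb i j)

-- Cycle indices: Fin 5, where index c_i stands for v_i (i = 1..5).

c1 c2 c3 c4 c5 : Fin 5
c1 = zero
c2 = suc zero
c3 = suc (suc zero)
c4 = suc (suc (suc zero))
c5 = suc (suc (suc (suc zero)))

nxt prv : Fin 5 → Fin 5
nxt zero = c2
nxt (suc zero) = c3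
nxt (suc (suc zero)) = c4
nxt (suc (suc (suc zero))) = c5
nxt (suc (suc (suc (suc zero)))) = c1
prv zero = c5
prv (suc zero) = c1
prv (suc (suc zero)) = c2
prv (suc (suc (suc zero))) = c3
prv (suc (suc (suc (suc zero)))) = c4

C5 : Fin 5 → Fin 5 → Bool
C5 i j = eqb j (prv i) ∨ eqb j (nxt i)

-- The T-5-wheel on Fin 6: inject₁ i = v_(i+1) (i.e. vertices 0..4 are
-- v1..v5), and the last vertex xT = fromℕ 5 is x, adjacent exactly to
-- v1, v2, v5.
xT : Fin 6
xT = fromℕ 5

xNbr : Fin 5 → Bool
xNbr j = eqb j c1 ∨ eqb j c2 ∨ eqb j c5

view : Fin 6 → Maybe (Fin 5)
view zero = just c1
view (suc zero) = just c2
view (suc (suc zero)) = just c3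
view (suc (suc (suc zero))) = just c4
view (suc (suc (suc (suc zero)))) = just c5
view (suc (suc (suc (suc (suc zero))))) = nothing

T5W' : Maybe (Fin 5) → Maybe (Fin 5) → Bool
T5W' nothing nothing = false
T5W' nothing (just j) = xNbr j
T5W' (just i) nothing = xNbr i
T5W' (just i) (just j) = C5 i j

T5W : Fin 6 → Fin 6 → Bool
T5W i j = T5W' (view i) (view j)

T5Wheel : Graph → Set
T5Wheel G = InducedCopy G T5W

module Wheel (G : Graph) (W : T5Wheel G) where
  emb : Fin 6 → Fin (n G)
  emb = proj₁ W

  v : Fin 5 → Fin (n G)
  v j = emb (inject₁ j)

  x : Fin (n G)
  x = emb xT

  NCis : Fin (n G) → (Fin 5 → Bool) → Set
  NCis u p = ∀ j → adj G u (v j) ≡ p j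

  patR patRbar patP : Fin 5 → Fin 5 → Bool
  patR i j = eqb j (prv i) ∨ eqb j (nxt i)
  patRbar i j = eqb j (prv i) ∨ eqb j i ∨ eqb j (nxt i)
  patP i j = eqb j (prv i) ∨ eqb j i ∨ eqb j (nxt i) ∨ eqb j (nxt (nxt i))

  R Rbar P Rx Rbarx : Fin 5 → Fin (n G) → Set
  R i u = adj G u x ≡ false × NCis u (patR i)
  Rbar i u = adj G u x ≡ false × NCis u (patRbar i)
  P i u = adj G u x ≡ false × NCis u (patP i)
  Rx i u = adj G u x ≡ true × NCis u (patR i)
  Rbarx i u = adj G u x ≡ true × NCis u (patRbar i)

  S : Fin (n G) → Set
  S u = ∀ k → adj G u (emb k) ≡ false

  Anticomplete : (Fin (n G) → Set) → (Fin (n G) → Set) → Set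
  Anticomplete A B = ∀ a b → A a → B b → adj G a b ≡ false

-- Every vertex u of the listed classes sees exactly one end a of some induced
-- three-vertex path a–b–c of Σ.  A vertex s ∈ S adjacent to u would then span
-- the induced path s–u–a–b–c, a P₅; so only P₅-freeness is needed.
module Submission where

open import Defs
open import Data.Bool using (Bool; true; false)
import Data.Bool.Properties as Bool
open import Data.Empty using (⊥)
open import Data.Fin using (Fin; zero; suc; inject₁)
open import Data.Nat using (ℕ)
import Data.Fin.Properties as Fin
open import Data.Product using (_×_; _,_; proj₂)
open import Data.Sum using (_⊎_; [_,_])
open import Relation.Nullary using (Dec)
open import Relation.Nullary.Decidable using (toWitness; _→-dec_)
open import Relation.Binary.PropositionalEquality
  using (_≡_; refl; trans; cong) renaming (sym to ≡-sym)

module _ {k : ℕ} (H : Fin k → Fin k → Bool) where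

  Twins : Fin k → Fin k → Set
  Twins i j = ∀ l → H i l ≡ H j l

  TwinFree : Set
  TwinFree = ∀ i j → Twins i j → i ≡ j

  twinFree? : Dec TwinFree
  twinFree? = Fin.all? λ i → Fin.all? λ j →
    Fin.all? (λ l → H i l Bool.≟ H j l) →-dec (i Fin.≟ j)

P5-twinFree : TwinFree P5
P5-twinFree = toWitness {a? = twinFree? P5} _

inducedCopy : (G : Graph) {k : ℕ} {H : Fin k → Fin k → Bool} → TwinFree H →
  (f : Fin k → Fin (n G)) → (∀ i j → adj G (f i) (f j) ≡ H i j) → InducedCopy G H
inducedCopy G {k} twinFree f realises = f , injective , realises
  where
  injective : (i j : Fin k) → f i ≡ f j → i ≡ j
  injective i j fi≡fj = twinFree i j λ l →
    trans (≡-sym (realises i l)) (trans (cong (λ y → adj G y (f l)) fi≡fj) (realises j l))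

module _ (G : Graph) where

  adj-sym : ∀ {a b} {c : Bool} → adj G a b ≡ c → adj G b a ≡ c
  adj-sym {a} {b} ab = trans (Graph.sym G b a) ab

  inducedP5 : {p₀ p₁ p₂ p₃ p₄ : Fin (n G)} →
    adj G p₀ p₁ ≡ true  → adj G p₀ p₂ ≡ false → adj G p₀ p₃ ≡ false → adj G p₀ p₄ ≡ false →
    adj G p₁ p₂ ≡ true  → adj G p₁ p₃ ≡ false → adj G p₁ p₄ ≡ false →
    adj G p₂ p₃ ≡ true  → adj G p₂ p₄ ≡ false →
    adj G p₃ p₄ ≡ true  → InducedCopy G P5
  inducedP5 {p₀} {p₁} {p₂} {p₃} {p₄} e₀₁ e₀₂ e₀₃ e₀₄ e₁₂ e₁₃ e₁₄ e₂₃ e₂₄ e₃₄ =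
    inducedCopy G P5-twinFree p realises
    where
    p : Fin 5 → Fin (n G)
    p zero                      = p₀
    p (suc zero)                = p₁
    p (suc (suc zero))          = p₂
    p (suc (suc (suc zero)))    = p₃
    p (suc (suc (suc (suc _)))) = p₄

    realises : ∀ i j → adj G (p i) (p j) ≡ P5 i j
    realises zero                             zero                             = irrefl G p₀
    realises zero                             (suc zero)                       = e₀₁
    realises zero                             (suc (suc zero))                 = e₀₂
    realises zero                             (suc (suc (suc zero)))           = e₀₃
    realises zero                             (suc (suc (suc (suc zero))))     = e₀₄
    realises (suc zero)                       zero                             = adj-sym e₀₁
    realises (suc zero)                       (suc zero)                       = irrefl G p₁
    realises (suc zero)                       (suc (suc zero))                 = e₁₂
    realises (suc zero)                       (suc (suc (suc zero)))           = e₁₃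
    realises (suc zero)                       (suc (suc (suc (suc zero))))     = e₁₄
    realises (suc (suc zero))                 zero                             = adj-sym e₀₂
    realises (suc (suc zero))                 (suc zero)                       = adj-sym e₁₂
    realises (suc (suc zero))                 (suc (suc zero))                 = irrefl G p₂
    realises (suc (suc zero))                 (suc (suc (suc zero)))           = e₂₃
    realises (suc (suc zero))                 (suc (suc (suc (suc zero))))     = e₂₄
    realises (suc (suc (suc zero)))           zero                             = adj-sym e₀₃
    realises (suc (suc (suc zero)))           (suc zero)                       = adj-sym e₁₃
    realises (suc (suc (suc zero)))           (suc (suc zero))                 = adj-sym e₂₃
    realises (suc (suc (suc zero)))           (suc (suc (suc zero)))           = irrefl G p₃
    realises (suc (suc (suc zero)))           (suc (suc (suc (suc zero))))     = e₃₄
    realises (suc (suc (suc (suc zero))))     zero                             = adj-sym e₀₄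
    realises (suc (suc (suc (suc zero))))     (suc zero)                       = adj-sym e₁₄
    realises (suc (suc (suc (suc zero))))     (suc (suc zero))                 = adj-sym e₂₄
    realises (suc (suc (suc (suc zero))))     (suc (suc (suc zero)))           = adj-sym e₃₄
    realises (suc (suc (suc (suc zero))))     (suc (suc (suc (suc zero))))     = irrefl G p₄

module _ (G : Graph) (P5-free : Free G P5) (W : T5Wheel G) where
  open Wheel G W

  emb-realises : ∀ i j → adj G (emb i) (emb j) ≡ T5W i j
  emb-realises = proj₂ (proj₂ W)

  anticomplete-⊎ : ∀ {A B C : Fin (n G) → Set} →
    Anticomplete A B → Anticomplete A C → Anticomplete A (λ u → B u ⊎ C u)
  anticomplete-⊎ A∼B A∼C a u Aa = [ A∼B a u Aa , A∼C a u Aa ]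

  S-anticomplete-if-sees-end-of-P3 : ∀ {B : Fin (n G) → Set} (a b c : Fin 6) →
    T5W a b ≡ true → T5W b c ≡ true → T5W a c ≡ false →
    (∀ {u} → B u → adj G u (emb a) ≡ true × adj G u (emb b) ≡ false × adj G u (emb c) ≡ false) →
    Anticomplete S B
  S-anticomplete-if-sees-end-of-P3 a b c ab bc ac sees s u Ss Bu = Bool.¬-not s≁u
    where
    s≁u : adj G s u ≡ true → ⊥
    s≁u su with sees Bu
    ... | ua , ub , uc = P5-free (inducedP5 G su (Ss a) (Ss b) (Ss c) ua ub uc
      (trans (emb-realises a b) ab) (trans (emb-realises a c) ac) (trans (emb-realises b c) bc))

  v₁ v₂ v₃ v₄ v₅ : Fin 6
  v₁ = inject₁ c1
  v₂ = inject₁ c2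
  v₃ = inject₁ c3
  v₄ = inject₁ c4
  v₅ = inject₁ c5

  S-anticomplete-R-Rx-Rbar-Rbarx : Anticomplete S
    (λ u → R c1 u ⊎ R c3 u ⊎ R c4 u ⊎ Rx c1 u ⊎ Rx c2 u ⊎ Rx c5 u
         ⊎ Rbar c1 u ⊎ Rbarx c1 u ⊎ Rbar c3 u ⊎ Rbarx c3 u)
  S-anticomplete-R-Rx-Rbar-Rbarx =
    anticomplete-⊎ (via v₂ v₃ v₄ refl refl refl λ (_  , N) → N c2 , N c3 , N c4)
   (anticomplete-⊎ (via v₂ xT v₅ refl refl refl λ (ux , N) → N c2 , ux   , N c5)
   (anticomplete-⊎ (via v₃ v₂ xT refl refl refl λ (ux , N) → N c3 , N c2 , ux  )
   (anticomplete-⊎ (via v₂ v₃ v₄ refl refl refl λ (_  , N) → N c2 , N c3 , N c4)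
   (anticomplete-⊎ (via v₃ v₄ v₅ refl refl refl λ (_  , N) → N c3 , N c4 , N c5)
   (anticomplete-⊎ (via v₄ v₃ v₂ refl refl refl λ (_  , N) → N c4 , N c3 , N c2)
   (anticomplete-⊎ (via v₂ v₃ v₄ refl refl refl λ (_  , N) → N c2 , N c3 , N c4)
   (anticomplete-⊎ (via v₂ v₃ v₄ refl refl refl λ (_  , N) → N c2 , N c3 , N c4)
   (anticomplete-⊎ (via v₂ xT v₅ refl refl refl λ (ux , N) → N c2 , ux   , N c5)
                   (via v₄ v₅ v₁ refl refl refl λ (_  , N) → N c4 , N c5 , N c1)
   ))))))))
    where via = S-anticomplete-if-sees-end-of-P3

  S-anticomplete-P : Anticomplete S (λ u → P c2 u ⊎ P c4 u)
  S-anticomplete-P =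
    anticomplete-⊎ (via v₄ v₅ xT refl refl refl λ (ux , N) → N c4 , N c5 , ux)
                   (via v₃ v₂ xT refl refl refl λ (ux , N) → N c3 , N c2 , ux)
    where via = S-anticomplete-if-sees-end-of-P3

lemma3p4 : (G : Graph) → Free G P5 → Free G HVN → (W : T5Wheel G) →
    let open Wheel G W in
      Anticomplete S (λ u → R c1 u ⊎ R c3 u ⊎ R c4 u ⊎ Rx c1 u ⊎ Rx c2 u ⊎ Rx c5 u
                         ⊎ Rbar c1 u ⊎ Rbarx c1 u ⊎ Rbar c3 u ⊎ Rbarx c3 u)
      × Anticomplete S (λ u → P c2 u ⊎ P c4 u)
lemma3p4 G P5-free _ W =
  S-anticomplete-R-Rx-Rbar-Rbarx G P5-free W , S-anticomplete-P G P5-free W
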